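{- Let $S$ be a closed context-free semi-Thue system over $\Sigma$. The rules $\mathit{actr}$ (deriving $\Gamma[A]$ from $\Gamma[A,A]$, for a formula $A$) and $m$ (deriving $\Gamma[a\{\Delta_1,\Delta_2\}]$ from $\Gamma[a\{\Delta_1\},a\{\Delta_2\}]$) are height-preserving admissible in $\mathrm{DKm}(S)$.
   Context: $\Sigma$: alphabet with involution $a\mapsto\bar a$; $\overline{a_1\cdots a_n}=\bar a_n\cdots\bar a_1$. A semi-Thue system $S$ is a set of rules $u\to v$ ($u,v\in\Sigma^*$); closed if $u\to v\in S\Rightarrow\bar u\to\bar v\in S$; context-free if all rules have form $a\to u$, $a\in\Sigma$. $L_a(S)=\{u\mid a\Rightarrow_S u\}$. Formulae are in negation normal form. A nested sequent is a finite multiset of formulae and structures $a\{\Delta\}$, viewed as a tree with nodes carrying multisets of formulae and $\Sigma$-labelled edges. Contexts $\Gamma[\ ]$, $\Gamma[\ ]_i[\ ]_j$ have holes at nodes. $\mathcal R(\Gamma,i,j)$: automaton with the nodes as states, initial $i$, final $j$, transitions $x\xrightarrow{a}y$, $y\xrightarrow{\bar a}x$ for each edge $x\xrightarrow{a}y$. $\mathrm{DKm}(S)$ rules (conclusion from premises): $\mathit{id}_d$: $\Gamma[p,\neg p]$; $\land_d$: $\Gamma[A\land B]$ from $\Gamma[A\land B,A]$, $\Gamma[A\land B,B]$; $\lor_d$: $\Gamma[A\lor B]$ from $\Gamma[A\lor B,A,B]$; $[a]_d$: $\Gamma[[a]A]$ from $\Gamma[[a]A,a\{A\}]$; $\langle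 a\rangle\!\uparrow$: $\Gamma[a\{\Delta\},\langle a\rangle A]$ from $\Gamma[a\{\Delta,A\},\langle a\rangle A]$; $\langle a\rangle\!\downarrow$: $\Gamma[a\{\Delta,\langle\bar a\rangle A\}]$ from $\Gamma[a\{\Delta,\langle\bar a\rangle A\},A]$; $p_S$: $\Gamma[\langle a\rangle A]_i[\emptyset]_j$ from $\Gamma[\langle a\rangle A]_i[A]_j$ provided $\mathcal R(\Gamma[\ ]_i[\ ]_j,i,j)\cap L_a(S)\neq\emptyset$. Height-preserving admissible: whenever the premise has a derivation of height $h$, the conclusion has a derivation of height $h$ (height = edges on longest branch). -}

module Defs where

open import Data.Nat using (ℕ; suc)
open import Data.List using (List; []; _∷_; _++_; [_]; reverse; map)
open import Data.List.Membership.Propositional using (_∈_)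
open import Data.Product using (Σ; ∃; _×_; _,_)
open import Relation.Binary.PropositionalEquality using (_≡_)
open import Relation.Binary.Construct.Closure.ReflexiveTransitive using (Star)

record Alphabet : Set₁ where
  field
    Sym  : Set
    bar  : Sym → Sym
    bar-invol : ∀ a → bar (bar a) ≡ a

module _ (Al : Alphabet) where
  open Alphabet Al

  barW : List Sym → List Sym
  barW w = reverse (map bar w)

  SemiThue : Set₁
  SemiThue = List Sym → List Sym → Set

  Closed : SemiThue → Set
  Closed S = ∀ u v → S u v → S (barW u) (barW v)

  ContextFree : SemiThue → Set
  ContextFree S = ∀ u v → S u v → ∃ λ a → u ≡ [ a ]

  data Step (S : SemiThue) : List Sym → List Sym → Set where
    step : ∀ x u v y → S u v → Step S (x ++ u ++ y) (x ++ v ++ y)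

  InL : SemiThue → Sym → List Sym → Set
  InL S a u = Star (Step S) [ a ] u

  module Logic (Atom : Set) where

    data Fml : Set where
      atom  : Atom → Fml
      natom : Atom → Fml
      _∧ᶠ_  : Fml → Fml → Fml
      _∨ᶠ_  : Fml → Fml → Fml
      box   : Sym → Fml → Fml
      dia   : Sym → Fml → Fml

    -- nested sequents: lists of items, read up to multiset equivalence _≈_
    data Item : Set where
      fml : Fml → Item
      br  : Sym → List Item → Item

    Seq : Set
    Seq = List Item

    data _≈ᵢ_ : Item → Item → Set
    data _≈_ : Seq → Seq → Set

    data _≈ᵢ_ where
      fml : ∀ F → fml F ≈ᵢ fml F
      br  : ∀ a {Γ Δ} → Γ ≈ Δ → br a Γ ≈ᵢ br a Δ

    data _≈_ where
      []    : [] ≈ []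
      _∷_   : ∀ {x y Γ Δ} → x ≈ᵢ y → Γ ≈ Δ → (x ∷ Γ) ≈ (y ∷ Δ)
      swap  : ∀ x y Γ → (x ∷ y ∷ Γ) ≈ (y ∷ x ∷ Γ)
      trans : ∀ {Γ Δ Θ} → Γ ≈ Δ → Δ ≈ Θ → Γ ≈ Θ

    data Child : Seq → Sym → Seq → Set where
      hd : ∀ {a Δ Γ} → Child (br a Δ ∷ Γ) a Δ
      tl : ∀ {x a Δ Γ} → Child Γ a Δ → Child (x ∷ Γ) a Δ

    data Pos : Seq → Set where
      here  : ∀ {Γ} → Pos Γ
      there : ∀ {Γ a Δ} → Child Γ a Δ → Pos Δ → Pos Γ

    replace : ∀ {Γ a Δ} → Child Γ a Δ → Seq → Seq
    replace {br a _ ∷ Γ} hd Δ' = br a Δ' ∷ Γ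
    replace {x ∷ Γ} (tl c) Δ' = x ∷ replace c Δ'

    -- Γ[Θ] : add the multiset Θ at node i of Γ (context = sequent + node)
    ins : (Γ : Seq) → Pos Γ → Seq → Seq
    ins Γ here Θ = Θ ++ Γ
    ins Γ (there {Δ = Δ} c p) Θ = replace c (ins Δ p Θ)

    nodeAt : (Γ : Seq) → Pos Γ → Seq
    nodeAt Γ here = Γ
    nodeAt Γ (there {Δ = Δ} c p) = nodeAt Δ p

    data Edge : {Γ : Seq} → Pos Γ → Sym → Pos Γ → Set where
      root : ∀ {Γ a Δ} (c : Child Γ a Δ) → Edge {Γ} here a (there c here)
      deep : ∀ {Γ a Δ b} {c : Child Γ a Δ} {x y : Pos Δ} →
             Edge x b y → Edge (there c x) b (there c y)

    -- words accepted by R(Γ, i, j): walks i → j, edges traversed forward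
    -- read a, traversed backward read ā
    data Walk {Γ : Seq} : Pos Γ → Pos Γ → List Sym → Set where
      stop : ∀ {x} → Walk x x []
      fwd  : ∀ {x y z a w} → Edge x a y → Walk y z w → Walk x z (a ∷ w)
      bwd  : ∀ {x y z a w} → Edge x a y → Walk x z w → Walk y z (bar a ∷ w)

    -- DKm(S); Der S h Γ : Γ has a derivation of height ≤ h
    -- (height = number of rule applications on the longest branch;
    --  exchange, i.e. multiset equality, is free).
    data Der (S : SemiThue) : ℕ → Seq → Set where
      exch : ∀ {h Γ Γ'} → Γ ≈ Γ' → Der S h Γ' → Der S h Γ
      idd  : ∀ {h} Γ i p →
             Der S h (ins Γ i (fml (atom p) ∷ fml (natom p) ∷ []))
      ∧d   : ∀ {h} Γ i A B →
             Der S h (ins Γ i (fml (A ∧ᶠ B) ∷ fml A ∷ [])) →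
             Der S h (ins Γ i (fml (A ∧ᶠ B) ∷ fml B ∷ [])) →
             Der S (suc h) (ins Γ i (fml (A ∧ᶠ B) ∷ []))
      ∨d   : ∀ {h} Γ i A B →
             Der S h (ins Γ i (fml (A ∨ᶠ B) ∷ fml A ∷ fml B ∷ [])) →
             Der S (suc h) (ins Γ i (fml (A ∨ᶠ B) ∷ []))
      boxd : ∀ {h} Γ i a A →
             Der S h (ins Γ i (fml (box a A) ∷ br a (fml A ∷ []) ∷ [])) →
             Der S (suc h) (ins Γ i (fml (box a A) ∷ []))
      dia↑ : ∀ {h} Γ i a Δ A →
             Der S h (ins Γ i (br a (Δ ++ fml A ∷ []) ∷ fml (dia a A) ∷ [])) →
             Der S (suc h) (ins Γ i (br a Δ ∷ fml (dia a A) ∷ []))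
      dia↓ : ∀ {h} Γ i a Δ A →
             Der S h (ins Γ i (br a (Δ ++ fml (dia (bar a) A) ∷ []) ∷ fml A ∷ [])) →
             Der S (suc h) (ins Γ i (br a (Δ ++ fml (dia (bar a) A) ∷ []) ∷ []))
      pS   : ∀ {h} Γ (i j : Pos Γ) a A →
             fml (dia a A) ∈ nodeAt Γ i →
             (∃ λ w → Walk i j w × InL S a w) →
             Der S h (ins Γ j (fml A ∷ [])) →
             Der S (suc h) Γ

    ActrHPA : SemiThue → Set
    ActrHPA S = ∀ h Γ (i : Pos Γ) A →
      Der S h (ins Γ i (fml A ∷ fml A ∷ [])) → Der S h (ins Γ i (fml A ∷ []))

    MHPA : SemiThue → Set
    MHPA S = ∀ h Γ (i : Pos Γ) a Δ₁ Δ₂ →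
      Der S h (ins Γ i (br a Δ₁ ∷ br a Δ₂ ∷ [])) →
      Der S h (ins Γ i (br a (Δ₁ ++ Δ₂) ∷ []))

-- Every rule of DKm(S) keeps its principal formula or structure in its
-- premises, so whether a rule applies depends only on which formulae occur at
-- which nodes and on the edges between nodes, not on multiplicities nor on
-- whether two equally labelled sibling structures are kept apart.  Hence
-- derivability is preserved, height for height, along the embedding Γ ⊑ Γ′
-- that sends each formula of a node to an equal formula of the image node and
-- each structure a{Δ} to an a-structure of the image node whose content
-- embeds Δ; walks, and with them the side condition of p_S, are carried
-- along.  Both Γ[A, A] ⊑ Γ[A] and Γ[a{Δ₁}, a{Δ₂}] ⊑ Γ[a{Δ₁, Δ₂}] hold.
module Submission where

open import Defs
open import Data.Product using (_×_; ∃; _,_)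
open import Data.List using ([]; _∷_; _++_; [_])
open import Data.List.Membership.Propositional using (_∈_)
open import Data.List.Membership.Propositional.Properties using (∈-++⁺ʳ)
open import Data.List.Relation.Unary.Any using (here; there)
open import Data.List.Relation.Unary.All as All using (All; []; _∷_)
open import Data.List.Relation.Unary.All.Properties using (++⁺; ++⁻ˡ; ++⁻ʳ)
open import Data.List.Relation.Binary.Subset.Propositional using (_⊆_)
open import Data.List.Relation.Binary.Subset.Propositional.Properties
  using (xs⊆xs++ys; xs⊆ys++xs; ⊆-reflexive-↭)
open import Data.List.Relation.Binary.Permutation.Propositional using (↭-refl; ↭-swap)
open import Function using (id; _∘_)
open import Relation.Nullary using (contradiction)
open import Relation.Binary.PropositionalEquality
  using (_≡_; _≢_; refl; sym; cong; subst; subst₂; module ≡-Reasoning)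
  renaming (trans to trans≡)

module _ (Al : Alphabet) (Atom : Set) where
  open Alphabet Al
  open Logic Al Atom

  ≈ᵢ-refl : ∀ x → x ≈ᵢ x
  ≈-refl : ∀ Γ → Γ ≈ Γ
  ≈ᵢ-refl (fml F) = fml F
  ≈ᵢ-refl (br a Δ) = br a (≈-refl Δ)
  ≈-refl [] = []
  ≈-refl (x ∷ Γ) = ≈ᵢ-refl x ∷ ≈-refl Γ

  ≈ᵢ-sym : ∀ {x y} → x ≈ᵢ y → y ≈ᵢ x
  ≈-sym : ∀ {Γ Δ} → Γ ≈ Δ → Δ ≈ Γ
  ≈ᵢ-sym (fml F) = fml F
  ≈ᵢ-sym (br a Γ≈Δ) = br a (≈-sym Γ≈Δ)
  ≈-sym [] = []
  ≈-sym (x≈y ∷ Γ≈Δ) = ≈ᵢ-sym x≈y ∷ ≈-sym Γ≈Δ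
  ≈-sym (swap x y Γ) = swap y x Γ
  ≈-sym (trans Γ≈Δ Δ≈Θ) = trans (≈-sym Δ≈Θ) (≈-sym Γ≈Δ)

  ∷≈∷ʳ : ∀ x L → (x ∷ L) ≈ (L ++ [ x ])
  ∷≈∷ʳ x [] = ≈-refl _
  ∷≈∷ʳ x (y ∷ L) = trans (swap x y L) (≈ᵢ-refl y ∷ ∷≈∷ʳ x L)

  extract : ∀ {x L} → x ∈ L → ∃ λ N → L ≈ (x ∷ N) × L ⊆ (x ∷ N)
  extract {L = y ∷ L} (here refl) = L , ≈-refl _ , id
  extract {x} {y ∷ L} (there x∈L) =
    let N , L≈x∷N , L⊆x∷N = extract x∈L
    in y ∷ N , trans (≈ᵢ-refl y ∷ L≈x∷N) (swap y x N) , y∷L⊆ L⊆x∷N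
    where
      y∷L⊆ : ∀ {N} → L ⊆ (x ∷ N) → (y ∷ L) ⊆ (x ∷ y ∷ N)
      y∷L⊆ L⊆ (here z≡y) = there (here z≡y)
      y∷L⊆ L⊆ (there z∈L) with L⊆ z∈L
      ... | here z≡x = here z≡x
      ... | there z∈N = there (there z∈N)

  extract₂ : ∀ {x y L} → x ∈ L → y ∈ L → x ≢ y → ∃ λ N → L ≈ (x ∷ y ∷ N)
  extract₂ {x} x∈L y∈L x≢y with extract x∈L
  ... | N , L≈x∷N , L⊆x∷N with L⊆x∷N y∈L
  ...   | here y≡x = contradiction (sym y≡x) x≢y
  ...   | there y∈N with extract y∈N
  ...     | M , N≈y∷M , _ = M , trans L≈x∷N (≈ᵢ-refl x ∷ N≈y∷M)

  data _⊑ᵢ_ : Item → Seq → Set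

  _⊑_ : Seq → Seq → Set
  Γ ⊑ L = All (_⊑ᵢ L) Γ

  data _⊑ᵢ_ where
    fml : ∀ {F L} → fml F ∈ L → fml F ⊑ᵢ L
    br  : ∀ {a Δ Δ′ L} → br a Δ′ ∈ L → Δ ⊑ Δ′ → br a Δ ⊑ᵢ L

  ⊑-refl : ∀ {Γ} → Γ ⊑ Γ
  ⊆⇒⊑ : ∀ Γ {L} → Γ ⊆ L → Γ ⊑ L
  ⊑-refl = ⊆⇒⊑ _ id
  ⊆⇒⊑ [] Γ⊆L = []
  ⊆⇒⊑ (fml F ∷ Γ) Γ⊆L = fml (Γ⊆L (here refl)) ∷ ⊆⇒⊑ Γ (Γ⊆L ∘ there)
  ⊆⇒⊑ (br a Δ ∷ Γ) Γ⊆L = br (Γ⊆L (here refl)) ⊑-refl ∷ ⊆⇒⊑ Γ (Γ⊆L ∘ there)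

  xs⊑xs++ys : ∀ xs ys → xs ⊑ (xs ++ ys)
  xs⊑xs++ys xs ys = ⊆⇒⊑ xs (xs⊆xs++ys xs ys)

  xs⊑ys++xs : ∀ xs ys → xs ⊑ (ys ++ xs)
  xs⊑ys++xs xs ys = ⊆⇒⊑ xs (xs⊆ys++xs xs ys)

  ⊑ᵢ-⊆ : ∀ {x L M} → L ⊆ M → x ⊑ᵢ L → x ⊑ᵢ M
  ⊑ᵢ-⊆ L⊆M (fml F∈L) = fml (L⊆M F∈L)
  ⊑ᵢ-⊆ L⊆M (br b∈L Δ⊑Δ′) = br (L⊆M b∈L) Δ⊑Δ′

  ⊑-⊆ : ∀ {Γ L M} → L ⊆ M → Γ ⊑ L → Γ ⊑ M
  ⊑-⊆ L⊆M = All.map (⊑ᵢ-⊆ L⊆M)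

  ⊑ᵢ-trans : ∀ {x L M} → x ⊑ᵢ L → L ⊑ M → x ⊑ᵢ M
  ⊑-trans : ∀ {Γ L M} → Γ ⊑ L → L ⊑ M → Γ ⊑ M
  ⊑ᵢ-trans (fml F∈L) L⊑M = All.lookup L⊑M F∈L
  ⊑ᵢ-trans (br b∈L Δ⊑Δ′) L⊑M with All.lookup L⊑M b∈L
  ... | br b∈M Δ′⊑Δ″ = br b∈M (⊑-trans Δ⊑Δ′ Δ′⊑Δ″)
  ⊑-trans [] L⊑M = []
  ⊑-trans (x⊑L ∷ Γ⊑L) L⊑M = ⊑ᵢ-trans x⊑L L⊑M ∷ ⊑-trans Γ⊑L L⊑M

  ⊑-++⁺ : ∀ {X Y U V} → X ⊑ Y → U ⊑ V → (X ++ U) ⊑ (Y ++ V)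
  ⊑-++⁺ {Y = Y} X⊑Y U⊑V = ++⁺ (⊑-⊆ (xs⊆xs++ys Y _) X⊑Y) (⊑-⊆ (xs⊆ys++xs _ Y) U⊑V)

  ≈ᵢ⇒⊑ᵢ : ∀ {x y} → x ≈ᵢ y → x ⊑ᵢ [ y ]
  ≈⇒⊑ : ∀ {Γ Δ} → Γ ≈ Δ → Γ ⊑ Δ
  ≈ᵢ⇒⊑ᵢ (fml F) = fml (here refl)
  ≈ᵢ⇒⊑ᵢ (br a Γ≈Δ) = br (here refl) (≈⇒⊑ Γ≈Δ)
  ≈⇒⊑ [] = []
  ≈⇒⊑ (x≈y ∷ Γ≈Δ) = ⊑ᵢ-⊆ (xs⊆xs++ys _ _) (≈ᵢ⇒⊑ᵢ x≈y) ∷ ⊑-⊆ there (≈⇒⊑ Γ≈Δ)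
  ≈⇒⊑ (swap x y Γ) = ⊆⇒⊑ _ (⊆-reflexive-↭ (↭-swap x y ↭-refl))
  ≈⇒⊑ (trans Γ≈Δ Δ≈Θ) = ⊑-trans (≈⇒⊑ Γ≈Δ) (≈⇒⊑ Δ≈Θ)

  setNode : (Γ : Seq) → Pos Γ → Seq → Seq
  setNode Γ here W = W
  setNode Γ (there {Δ = Δ} c p) W = replace c (setNode Δ p W)

  -- replace computes on tl only once the item in front is a constructor,
  -- hence the case split on that item here and below.
  Child-replace : ∀ {Γ a Δ} (c : Child Γ a Δ) W → Child (replace c W) a W
  Child-replace hd W = hd
  Child-replace (tl {x = fml F} c) W = tl (Child-replace c W)
  Child-replace (tl {x = br b E} c) W = tl (Child-replace c W)

  replace-replace : ∀ {Γ a Δ} (c : Child Γ a Δ) W V →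
                    replace (Child-replace c W) V ≡ replace c V
  replace-replace hd W V = refl
  replace-replace (tl {x = fml F} c) W V = cong (fml F ∷_) (replace-replace c W V)
  replace-replace (tl {x = br b E} c) W V = cong (br b E ∷_) (replace-replace c W V)

  replace-self : ∀ {Γ a Δ} (c : Child Γ a Δ) → replace c Δ ≡ Γ
  replace-self hd = refl
  replace-self (tl {x = fml F} c) = cong (fml F ∷_) (replace-self c)
  replace-self (tl {x = br b E} c) = cong (br b E ∷_) (replace-self c)

  replace-cong : ∀ {Γ a Δ} (c : Child Γ a Δ) {V V′} → V ≈ V′ → replace c V ≈ replace c V′
  replace-cong hd V≈V′ = br _ V≈V′ ∷ ≈-refl _
  replace-cong (tl {x = fml F} c) V≈V′ = fml F ∷ replace-cong c V≈V′
  replace-cong (tl {x = br b E} c) V≈V′ = ≈ᵢ-refl _ ∷ replace-cong c V≈V′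

  setNode-pos : ∀ {Γ} (j : Pos Γ) W → Pos (setNode Γ j W)
  setNode-pos here W = here
  setNode-pos (there {Δ = Δ} c p) W = there (Child-replace c (setNode Δ p W)) (setNode-pos p W)

  nodeAt-setNode : ∀ {Γ} (j : Pos Γ) W → nodeAt (setNode Γ j W) (setNode-pos j W) ≡ W
  nodeAt-setNode here W = refl
  nodeAt-setNode (there c p) W = nodeAt-setNode p W

  setNode-setNode : ∀ {Γ} (j : Pos Γ) W V →
                    setNode (setNode Γ j W) (setNode-pos j W) V ≡ setNode Γ j V
  setNode-setNode here W V = refl
  setNode-setNode (there {Δ = Δ} c p) W V = begin
    replace (Child-replace c (setNode Δ p W)) (setNode (setNode Δ p W) (setNode-pos p W) V)
      ≡⟨ replace-replace c (setNode Δ p W) _ ⟩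
    replace c (setNode (setNode Δ p W) (setNode-pos p W) V)
      ≡⟨ cong (replace c) (setNode-setNode p W V) ⟩
    replace c (setNode Δ p V) ∎
    where open ≡-Reasoning

  setNode-nodeAt : ∀ Γ (j : Pos Γ) → setNode Γ j (nodeAt Γ j) ≡ Γ
  setNode-nodeAt Γ here = refl
  setNode-nodeAt Γ (there {Δ = Δ} c p) rewrite setNode-nodeAt Δ p = replace-self c

  ins≡setNode : ∀ Γ (j : Pos Γ) Z → ins Γ j Z ≡ setNode Γ j (Z ++ nodeAt Γ j)
  ins≡setNode Γ here Z = refl
  ins≡setNode Γ (there {Δ = Δ} c p) Z = cong (replace c) (ins≡setNode Δ p Z)

  setNode-cong : ∀ Γ (j : Pos Γ) {V V′} → V ≈ V′ → setNode Γ j V ≈ setNode Γ j V′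
  setNode-cong Γ here V≈V′ = V≈V′
  setNode-cong Γ (there {Δ = Δ} c p) V≈V′ = replace-cong c (setNode-cong Δ p V≈V′)

  Child⇒∈ : ∀ {Γ a Δ} → Child Γ a Δ → br a Δ ∈ Γ
  Child⇒∈ hd = here refl
  Child⇒∈ (tl c) = there (Child⇒∈ c)

  ∈⇒Child : ∀ {Γ a Δ} → br a Δ ∈ Γ → Child Γ a Δ
  ∈⇒Child (here refl) = hd
  ∈⇒Child (there b∈Γ) = tl (∈⇒Child b∈Γ)

  replace-⊑ : ∀ {Γ a Δ} (c : Child Γ a Δ) {V L} → br a V ⊑ᵢ L → Γ ⊑ L → replace c V ⊑ L
  replace-⊑ hd b⊑L (_ ∷ Γ⊑L) = b⊑L ∷ Γ⊑L
  replace-⊑ (tl {x = fml F} c) b⊑L (x⊑L ∷ Γ⊑L) = x⊑L ∷ replace-⊑ c b⊑L Γ⊑L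
  replace-⊑ (tl {x = br _ _} c) b⊑L (x⊑L ∷ Γ⊑L) = x⊑L ∷ replace-⊑ c b⊑L Γ⊑L

  replace-mono : ∀ {Γ a Δ} (c : Child Γ a Δ) {V V′} → V ⊑ V′ → replace c V ⊑ replace c V′
  replace-mono hd V⊑V′ = br (here refl) V⊑V′ ∷ ⊑-⊆ there ⊑-refl
  replace-mono (tl {x = fml F} c) V⊑V′ = fml (here refl) ∷ ⊑-⊆ there (replace-mono c V⊑V′)
  replace-mono (tl {x = br _ _} c) V⊑V′ = br (here refl) ⊑-refl ∷ ⊑-⊆ there (replace-mono c V⊑V′)

  setNode-mono : ∀ Γ (j : Pos Γ) {V V′} → V ⊑ V′ → setNode Γ j V ⊑ setNode Γ j V′
  setNode-mono Γ here V⊑V′ = V⊑V′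
  setNode-mono Γ (there {Δ = Δ} c p) V⊑V′ = replace-mono c (setNode-mono Δ p V⊑V′)

  ⊑-setNode : ∀ Γ (j : Pos Γ) {W} → nodeAt Γ j ⊑ W → Γ ⊑ setNode Γ j W
  ⊑-setNode Γ j node⊑W =
    subst (_⊑ setNode Γ j _) (setNode-nodeAt Γ j) (setNode-mono Γ j node⊑W)

  ins-mono : ∀ Γ (i : Pos Γ) {X Y} → X ⊑ Y → ins Γ i X ⊑ ins Γ i Y
  ins-mono Γ i {X} {Y} X⊑Y =
    subst₂ _⊑_ (sym (ins≡setNode Γ i X)) (sym (ins≡setNode Γ i Y))
      (setNode-mono Γ i (⊑-++⁺ X⊑Y ⊑-refl))

  record Cover (Γ′ : Seq) (a : Sym) (Δ : Seq) : Set where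
    field
      {content} : Seq
      child : Child Γ′ a content
      covers : Δ ⊑ content
  open Cover

  cover : ∀ {Γ Γ′ a Δ} → Γ ⊑ Γ′ → Child Γ a Δ → Cover Γ′ a Δ
  cover Γ⊑Γ′ c with All.lookup Γ⊑Γ′ (Child⇒∈ c)
  ... | br b∈Γ′ Δ⊑Δ′ = record { child = ∈⇒Child b∈Γ′ ; covers = Δ⊑Δ′ }

  mapPos : ∀ {Γ Γ′} → Γ ⊑ Γ′ → Pos Γ → Pos Γ′
  mapPos Γ⊑Γ′ here = here
  mapPos Γ⊑Γ′ (there c p) = there (child cv) (mapPos (covers cv) p)
    where cv = cover Γ⊑Γ′ c

  nodeAt-mapPos : ∀ {Γ Γ′} (Γ⊑Γ′ : Γ ⊑ Γ′) p → nodeAt Γ p ⊑ nodeAt Γ′ (mapPos Γ⊑Γ′ p)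
  nodeAt-mapPos Γ⊑Γ′ here = Γ⊑Γ′
  nodeAt-mapPos Γ⊑Γ′ (there c p) = nodeAt-mapPos (covers (cover Γ⊑Γ′ c)) p

  mapEdge : ∀ {Γ Γ′} (Γ⊑Γ′ : Γ ⊑ Γ′) {x a y} → Edge x a y →
            Edge (mapPos Γ⊑Γ′ x) a (mapPos Γ⊑Γ′ y)
  mapEdge Γ⊑Γ′ (root c) = root (child (cover Γ⊑Γ′ c))
  mapEdge Γ⊑Γ′ (deep {c = c} e) = deep (mapEdge (covers (cover Γ⊑Γ′ c)) e)

  mapWalk : ∀ {Γ Γ′} (Γ⊑Γ′ : Γ ⊑ Γ′) {x y w} → Walk x y w →
            Walk (mapPos Γ⊑Γ′ x) (mapPos Γ⊑Γ′ y) w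
  mapWalk Γ⊑Γ′ stop = stop
  mapWalk Γ⊑Γ′ (fwd e walk) = fwd (mapEdge Γ⊑Γ′ e) (mapWalk Γ⊑Γ′ walk)
  mapWalk Γ⊑Γ′ (bwd e walk) = bwd (mapEdge Γ⊑Γ′ e) (mapWalk Γ⊑Γ′ walk)

  setNode-mapPos : ∀ {Γ Γ′} (Γ⊑Γ′ : Γ ⊑ Γ′) p {Z W} →
                   nodeAt Γ′ (mapPos Γ⊑Γ′ p) ⊑ W → Z ⊑ W →
                   setNode Γ p Z ⊑ setNode Γ′ (mapPos Γ⊑Γ′ p) W
  setNode-mapPos Γ⊑Γ′ here node⊑W Z⊑W = Z⊑W
  setNode-mapPos {Γ′ = Γ′} Γ⊑Γ′ (there c p) {W = W} node⊑W Z⊑W =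
    replace-⊑ c
      (br (Child⇒∈ (Child-replace (child cv) _)) (setNode-mapPos (covers cv) p node⊑W Z⊑W))
      (⊑-trans Γ⊑Γ′ (⊑-setNode Γ′ (there (child cv) (mapPos (covers cv) p)) node⊑W))
    where cv = cover Γ⊑Γ′ c

  ins-mapPos : ∀ {Γ Γ′} (Γ⊑Γ′ : Γ ⊑ Γ′) p {X Y} → X ⊑ Y →
               ins Γ p X ⊑ ins Γ′ (mapPos Γ⊑Γ′ p) Y
  ins-mapPos {Γ} {Γ′} Γ⊑Γ′ p {X} {Y} X⊑Y =
    subst₂ _⊑_ (sym (ins≡setNode Γ p X)) (sym (ins≡setNode Γ′ (mapPos Γ⊑Γ′ p) Y))
      (setNode-mapPos Γ⊑Γ′ p (xs⊑ys++xs _ Y) (⊑-++⁺ X⊑Y (nodeAt-mapPos Γ⊑Γ′ p)))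

  record Image (Γ : Seq) (i : Pos Γ) (X Γ′ : Seq) : Set where
    field
      pos : Pos Γ′
      covered : X ⊑ nodeAt Γ′ pos
      transport : ∀ {Z W} → nodeAt Γ′ pos ⊑ W → Z ⊑ W → ins Γ i Z ⊑ setNode Γ′ pos W

  image : ∀ Γ i X {Γ′} → ins Γ i X ⊑ Γ′ → Image Γ i X Γ′
  image Γ i X {Γ′} ins⊑Γ′ = record
    { pos = j
    ; covered = ++⁻ˡ X V⊑node
    ; transport = λ {Z} {W} node⊑W Z⊑W →
        subst (_⊑ setNode Γ′ j W)
          (trans≡ (setNode-setNode i V (Z ++ nodeAt Γ i)) (sym (ins≡setNode Γ i Z)))
          (setNode-mapPos set⊑Γ′ (setNode-pos i V) node⊑W
            (++⁺ Z⊑W (⊑-trans (++⁻ʳ X V⊑node) node⊑W)))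
    }
    where
      V = X ++ nodeAt Γ i
      set⊑Γ′ : setNode Γ i V ⊑ Γ′
      set⊑Γ′ = subst (_⊑ Γ′) (ins≡setNode Γ i X) ins⊑Γ′
      j = mapPos set⊑Γ′ (setNode-pos i V)
      V⊑node : V ⊑ nodeAt Γ′ j
      V⊑node = subst (_⊑ nodeAt Γ′ j) (nodeAt-setNode i V) (nodeAt-mapPos set⊑Γ′ (setNode-pos i V))

  ins-setNode : ∀ {Γ} (j : Pos Γ) N Z → ins (setNode Γ j N) (setNode-pos j N) Z ≡ setNode Γ j (Z ++ N)
  ins-setNode {Γ} j N Z = begin
    ins (setNode Γ j N) (setNode-pos j N) Z
      ≡⟨ ins≡setNode _ (setNode-pos j N) Z ⟩
    setNode (setNode Γ j N) (setNode-pos j N) (Z ++ nodeAt (setNode Γ j N) (setNode-pos j N))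
      ≡⟨ cong (λ T → setNode (setNode Γ j N) (setNode-pos j N) (Z ++ T)) (nodeAt-setNode j N) ⟩
    setNode (setNode Γ j N) (setNode-pos j N) (Z ++ N)
      ≡⟨ setNode-setNode j N (Z ++ N) ⟩
    setNode Γ j (Z ++ N) ∎
    where open ≡-Reasoning

  -- Γ′ as a context whose hole holds X′: a rule applied at i in Γ can then be
  -- applied at the hole in Γ′.
  record Reframing (Γ : Seq) (i : Pos Γ) (X′ Γ′ : Seq) : Set where
    field
      frame : Seq
      hole : Pos frame
      ≈ins : Γ′ ≈ ins frame hole X′
      transport : ∀ {Z Z′} → X′ ⊑ Z′ → Z ⊑ Z′ → ins Γ i Z ⊑ ins frame hole Z′

  reframe : ∀ {Γ i X Γ′ X′ N} (f : Image Γ i X Γ′) →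
            nodeAt Γ′ (Image.pos f) ≈ (X′ ++ N) → Reframing Γ i X′ Γ′
  reframe {Γ} {i} {Γ′ = Γ′} {X′} {N} f node≈X′++N = record
    { frame = setNode Γ′ j N
    ; hole = setNode-pos j N
    ; ≈ins = subst₂ _≈_ (setNode-nodeAt Γ′ j) (sym (ins-setNode j N X′))
               (setNode-cong Γ′ j node≈X′++N)
    ; transport = λ {Z} {Z′} X′⊑Z′ Z⊑Z′ →
        subst (ins Γ i Z ⊑_) (sym (ins-setNode j N Z′))
          (Image.transport f (⊑-trans (≈⇒⊑ node≈X′++N) (⊑-++⁺ X′⊑Z′ ⊑-refl))
                             (⊑-⊆ (xs⊆xs++ys Z′ N) Z⊑Z′))
    }
    where j = Image.pos f

  reframe-formula : ∀ Γ i F {Γ′} → ins Γ i [ fml F ] ⊑ Γ′ → Reframing Γ i [ fml F ] Γ′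
  reframe-formula Γ i F ins⊑Γ′ with image Γ i _ ins⊑Γ′
  ... | f with Image.covered f
  ... | fml F∈node ∷ [] with extract F∈node
  ...   | _ , node≈F∷N , _ = reframe f node≈F∷N

  module _ (S : SemiThue Al) where
    open Reframing

    Der-mono : ∀ {h Γ Γ′} → Der S h Γ → Γ ⊑ Γ′ → Der S h Γ′
    Der-mono (exch Γ≈Γ₀ d) Γ⊑Γ′ = Der-mono d (⊑-trans (≈⇒⊑ (≈-sym Γ≈Γ₀)) Γ⊑Γ′)
    Der-mono (idd Γ i p) ins⊑Γ′ with image Γ i _ ins⊑Γ′
    ... | f with Image.covered f
    ... | fml p∈node ∷ fml ¬p∈node ∷ [] with extract₂ p∈node ¬p∈node (λ ())
    ...   | _ , node≈ = exch (≈ins r) (idd (frame r) (hole r) p)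
      where r = reframe f node≈
    Der-mono (∧d Γ i A B d₁ d₂) ins⊑Γ′ =
      exch (≈ins r) (∧d (frame r) (hole r) A B
        (Der-mono d₁ (transport r (xs⊑xs++ys _ _) ⊑-refl))
        (Der-mono d₂ (transport r (xs⊑xs++ys _ _) ⊑-refl)))
      where r = reframe-formula Γ i (A ∧ᶠ B) ins⊑Γ′
    Der-mono (∨d Γ i A B d) ins⊑Γ′ =
      exch (≈ins r) (∨d (frame r) (hole r) A B
        (Der-mono d (transport r (xs⊑xs++ys _ _) ⊑-refl)))
      where r = reframe-formula Γ i (A ∨ᶠ B) ins⊑Γ′
    Der-mono (boxd Γ i a A d) ins⊑Γ′ =
      exch (≈ins r) (boxd (frame r) (hole r) a A
        (Der-mono d (transport r (xs⊑xs++ys _ _) ⊑-refl)))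
      where r = reframe-formula Γ i (box a A) ins⊑Γ′
    Der-mono (dia↑ Γ i a Δ A d) ins⊑Γ′ with image Γ i _ ins⊑Γ′
    ... | f with Image.covered f
    ... | br {Δ′ = Δ′} b∈node Δ⊑Δ′ ∷ fml ◇A∈node ∷ [] with extract₂ b∈node ◇A∈node (λ ())
    ...   | _ , node≈ =
      exch (≈ins r) (dia↑ (frame r) (hole r) a Δ′ A
        (Der-mono d (transport r
          (br (here refl) (xs⊑xs++ys Δ′ _) ∷ fml (there (here refl)) ∷ [])
          (br (here refl) (⊑-++⁺ Δ⊑Δ′ ⊑-refl) ∷ fml (there (here refl)) ∷ []))))
      where r = reframe f node≈
    Der-mono (dia↓ Γ i a Δ A d) ins⊑Γ′ with image Γ i _ ins⊑Γ′
    ... | f with Image.covered f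
    ... | br {Δ′ = Δ′} b∈node Δ◇⊑Δ′ ∷ [] with All.lookup Δ◇⊑Δ′ (∈-++⁺ʳ Δ (here refl))
    ... | fml ◇∈Δ′ with extract ◇∈Δ′
    ...   | Δ″ , Δ′≈◇∷Δ″ , _ with extract b∈node
    ...     | _ , node≈ , _ =
      exch (≈ins r) (dia↓ (frame r) (hole r) a Δ″ A
        (Der-mono d (transport r (xs⊑xs++ys _ _)
          (br (here refl) (⊑-trans Δ◇⊑Δ′ (≈⇒⊑ Δ′≈Δ″◇)) ∷ fml (there (here refl)) ∷ []))))
      where
        Δ′≈Δ″◇ = trans Δ′≈◇∷Δ″ (∷≈∷ʳ _ Δ″)
        r = reframe f (trans node≈ (br a Δ′≈Δ″◇ ∷ ≈-refl _))
    Der-mono (pS Γ i j a A ◇A∈node (w , walk , w∈L) d) Γ⊑Γ′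
      with All.lookup (nodeAt-mapPos Γ⊑Γ′ i) ◇A∈node
    ... | fml ◇A∈node′ =
      pS _ (mapPos Γ⊑Γ′ i) (mapPos Γ⊑Γ′ j) a A ◇A∈node′ (w , mapWalk Γ⊑Γ′ walk , w∈L)
        (Der-mono d (ins-mapPos Γ⊑Γ′ j ⊑-refl))

    actr-hpa : ActrHPA S
    actr-hpa h Γ i A d = Der-mono d (ins-mono Γ i (fml (here refl) ∷ fml (here refl) ∷ []))

    m-hpa : MHPA S
    m-hpa h Γ i a Δ₁ Δ₂ d =
      Der-mono d (ins-mono Γ i
        (br (here refl) (xs⊑xs++ys Δ₁ Δ₂) ∷ br (here refl) (xs⊑ys++xs Δ₂ Δ₁) ∷ []))

lemma4p7 : (Al : Alphabet) (Atom : Set) (S : SemiThue Al) →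
    Closed Al S → ContextFree Al S →
    Logic.ActrHPA Al Atom S × Logic.MHPA Al Atom S
lemma4p7 Al Atom S _ _ = actr-hpa Al Atom S , m-hpa Al Atom S
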